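{- Let $D$ be a digraph. If $A\in Q(D)$ has the ASAP, then $A$ has the SP.
   Context: Digraphs are finite, without loops or parallel arcs; a digraph $D=(V,A)$ has vertex set $V=\{1,\dots,n\}$. $Q(D)$ is the set of real $n\times n$ matrices $B=[b_{u,w}]$ with $b_{u,u}\neq 0$ for all $u$, $b_{u,w}\neq 0$ if $u\neq w$ and there is an arc from $u$ to $w$, and $b_{u,w}=0$ if $u\neq w$ and there is no arc from $u$ to $w$. A matrix $B\in Q(D)$ has the Asymmetric Strong Arnold Property (ASAP) if the only real $n\times n$ matrix $X$ with $X\circ B=0$ (entrywise product), $X^TB=0$ and $BX^T=0$ is $X=0$. The support $\mathrm{supp}(x)$ of $x\in\mathbb{R}^n$ is $\{i: x_i\neq 0\}$. Two subsets $R,S$ (in this order) of $V(D)$ touch if $R\cap S\neq\emptyset$ or there is an arc from a vertex of $R$ to a vertex of $S$. A matrix $A$ has the Support Property (SP) with respect to $D$ if for every nonzero $x$ with $x^TA=0$ and every nonzero $y$ with $Ay=0$, $\mathrm{supp}(x)$ and $\mathrm{supp}(y)$ touch. -}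

module Defs where

open import Level using (Level; _⊔_; suc)
open import Data.Nat using (ℕ)
open import Data.Fin using (Fin; zero; suc)
open import Data.Bool using (Bool; true; false)
open import Data.Product using (Σ; ∃; _×_; _,_)
open import Data.Sum using (_⊎_)
open import Relation.Nullary using (¬_)
open import Relation.Binary.Core using (Rel)
open import Relation.Binary.Definitions using (Decidable)
open import Relation.Binary.Structures using (IsTotalOrder)
open import Relation.Binary.PropositionalEquality using (_≡_)
open import Algebra.Bundles using (CommutativeRing)

-- The real numbers, axiomatised as a (Dedekind-)complete ordered field.
-- Any two such structures are isomorphic, so quantifying over all of
-- them is the same as speaking about ℝ.  Decidability of equality is
-- included as a (classically valid) axiom of ℝ.

record RealField (c ℓ : Level) : Set (Level.suc (c ⊔ ℓ)) where
  field
    commutativeRing : CommutativeRing c ℓ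
  open CommutativeRing commutativeRing public
  field
    _≤_          : Rel Carrier ℓ
    isTotalOrder : IsTotalOrder _≈_ _≤_
    1≉0          : ¬ (1# ≈ 0#)
    inverse      : ∀ x → ¬ (x ≈ 0#) → ∃ λ y → x * y ≈ 1#
    +-mono-≤     : ∀ x y z → x ≤ y → (x + z) ≤ (y + z)
    *-nonneg     : ∀ x y → 0# ≤ x → 0# ≤ y → 0# ≤ (x * y)
    complete     : (P : Carrier → Set (c ⊔ ℓ)) → (∃ λ x → P x) →
                   (∃ λ b → ∀ x → P x → x ≤ b) →
                   ∃ λ s → (∀ x → P x → x ≤ s) ×
                           (∀ b → (∀ x → P x → x ≤ b) → s ≤ b)
    _≟_          : Decidable _≈_

record Digraph (n : ℕ) : Set where
  field
    arc      : Fin n → Fin n → Bool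
    loopless : ∀ u → arc u u ≡ false
open Digraph public

module _ {c ℓ : Level} (ℝ : RealField c ℓ) where
  open RealField ℝ

  Matrix : ℕ → Set c
  Matrix n = Fin n → Fin n → Carrier

  Vector : ℕ → Set c
  Vector n = Fin n → Carrier

  sumFin : ∀ {n} → (Fin n → Carrier) → Carrier
  sumFin {ℕ.zero}  f = 0#
  sumFin {ℕ.suc n} f = f Fin.zero + sumFin (λ i → f (Fin.suc i))

  InQ : ∀ {n} → Digraph n → Matrix n → Set ℓ
  InQ {n} D B =
    (∀ u → ¬ (B u u ≈ 0#)) ×
    (∀ u w → ¬ (u ≡ w) → arc D u w ≡ true → ¬ (B u w ≈ 0#)) ×
    (∀ u w → ¬ (u ≡ w) → arc D u w ≡ false → B u w ≈ 0#)

  ASAP : ∀ {n} → Matrix n → Set (c ⊔ ℓ)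
  ASAP {n} B = (X : Matrix n) →
    (∀ u w → X u w * B u w ≈ 0#) →
    (∀ u w → sumFin (λ k → X k u * B k w) ≈ 0#) →
    (∀ u w → sumFin (λ k → B u k * X w k) ≈ 0#) →
    ∀ u w → X u w ≈ 0#

  supp : ∀ {n} → Vector n → Fin n → Set ℓ
  supp x i = ¬ (x i ≈ 0#)

  Touch : ∀ {n} → Digraph n → (Fin n → Set ℓ) → (Fin n → Set ℓ) → Set ℓ
  Touch D R S = (∃ λ i → R i × S i) ⊎
                (∃ λ u → ∃ λ w → R u × S w × arc D u w ≡ true)

  IsZeroVec : ∀ {n} → Vector n → Set ℓ
  IsZeroVec x = ∀ i → x i ≈ 0#

  SP : ∀ {n} → Digraph n → Matrix n → Set (c ⊔ ℓ)
  SP {n} D A = (x y : Vector n) →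
    ¬ IsZeroVec x → (∀ j → sumFin (λ i → x i * A i j) ≈ 0#) →
    ¬ IsZeroVec y → (∀ i → sumFin (λ j → A i j * y j) ≈ 0#) →
    Touch D (supp x) (supp y)

{-# OPTIONS --safe #-}
module Submission where

-- Suppose x is a nonzero left null vector and y a nonzero right null vector of A whose
-- supports do not touch.  The rank-one matrix X = x yᵀ vanishes wherever A may be
-- nonzero (on the diagonal and on the arcs), so X ∘ A = 0; moreover Xᵀ A = y (xᵀ A) = 0
-- and A Xᵀ = (A y) xᵀ = 0.  The ASAP then forces X = 0, contradicting x_i y_j ≠ 0.

open import Defs
open import Level using (Level)
open import Data.Nat using (ℕ; zero; suc)
open import Data.Fin using (Fin)
open import Data.Fin.Properties using (any?; ¬∀⟶∃¬) renaming (_≟_ to _≟ᶠ_)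
open import Data.Bool using (true; false)
open import Data.Bool.Properties using () renaming (_≟_ to _≟ᵇ_)
open import Data.Product using (∃; _,_)
open import Data.Sum using (inj₁; inj₂)
open import Data.Empty using (⊥-elim)
open import Relation.Nullary using (¬_; Dec; yes; no)
open import Relation.Nullary.Decidable using (¬?; _×-dec_; _⊎-dec_; decidable-stable)
open import Relation.Binary.PropositionalEquality using (_≡_) renaming (refl to ≡-refl)

module RealMatrixLemmas {c ℓ : Level} (ℝ : RealField c ℓ) where
  open RealField ℝ
  open import Relation.Binary.Reasoning.Setoid setoid
  open import Algebra.Properties.CommutativeSemigroup *-commutativeSemigroup
    using (x∙yz≈y∙xz; xy∙z≈y∙xz)

  x*y≉0 : ∀ {x y} → ¬ x ≈ 0# → ¬ y ≈ 0# → ¬ x * y ≈ 0#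
  x*y≉0 {x} {y} x≉0 y≉0 xy≈0 with inverse x x≉0
  ... | x⁻¹ , xx⁻¹≈1 = y≉0 (begin
    y              ≈⟨ sym (*-identityˡ y) ⟩
    1# * y         ≈⟨ *-congʳ (sym xx⁻¹≈1) ⟩
    (x * x⁻¹) * y  ≈⟨ xy∙z≈y∙xz x x⁻¹ y ⟩
    x⁻¹ * (x * y)  ≈⟨ *-congˡ xy≈0 ⟩
    x⁻¹ * 0#       ≈⟨ zeroʳ x⁻¹ ⟩
    0#             ∎)

  sumFin-cong : ∀ {n} {f g : Fin n → Carrier} →
                (∀ k → f k ≈ g k) → sumFin ℝ f ≈ sumFin ℝ g
  sumFin-cong {zero}  f≈g = refl
  sumFin-cong {suc n} f≈g = +-cong (f≈g Fin.zero) (sumFin-cong (λ k → f≈g (Fin.suc k)))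

  *-distribˡ-sumFin : ∀ {n} a (f : Fin n → Carrier) →
                      a * sumFin ℝ f ≈ sumFin ℝ (λ k → a * f k)
  *-distribˡ-sumFin {zero}  a f = zeroʳ a
  *-distribˡ-sumFin {suc n} a f =
    trans (distribˡ a _ _) (+-congˡ (*-distribˡ-sumFin a (λ k → f (Fin.suc k))))

  sumFin-≈0-*ˡ : ∀ {n} a (f : Fin n → Carrier) →
                 sumFin ℝ f ≈ 0# → sumFin ℝ (λ k → a * f k) ≈ 0#
  sumFin-≈0-*ˡ a f Σf≈0 = begin
    sumFin ℝ (λ k → a * f k) ≈⟨ sym (*-distribˡ-sumFin a f) ⟩
    a * sumFin ℝ f           ≈⟨ *-congˡ Σf≈0 ⟩
    a * 0#                   ≈⟨ zeroʳ a ⟩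
    0#                       ∎

  ¬IsZeroVec⇒∃supp : ∀ {n} {x : Vector ℝ n} → ¬ IsZeroVec ℝ x → ∃ (supp ℝ x)
  ¬IsZeroVec⇒∃supp {n} {x} x≉0 = ¬∀⟶∃¬ n (λ i → x i ≈ 0#) (λ i → x i ≟ 0#) x≉0

  touch? : ∀ {n} (D : Digraph n) (x y : Vector ℝ n) →
           Dec (Touch ℝ D (supp ℝ x) (supp ℝ y))
  touch? D x y =
    any? (λ i → ¬? (x i ≟ 0#) ×-dec ¬? (y i ≟ 0#)) ⊎-dec
    any? (λ u → any? (λ w →
      ¬? (x u ≟ 0#) ×-dec ¬? (y w ≟ 0#) ×-dec (arc D u w ≟ᵇ true)))

  outer : ∀ {n} → Vector ℝ n → Vector ℝ n → Matrix ℝ n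
  outer x y u w = x u * y w

  outer-∘-≈0 : ∀ {n} (D : Digraph n) (A : Matrix ℝ n) {x y : Vector ℝ n} →
    (∀ u w → ¬ u ≡ w → arc D u w ≡ false → A u w ≈ 0#) →
    ¬ Touch ℝ D (supp ℝ x) (supp ℝ y) →
    ∀ u w → outer x y u w * A u w ≈ 0#
  outer-∘-≈0 D A {x} {y} offArc≈0 ¬touch u w with x u ≟ 0# | y w ≟ 0#
  ... | yes xu≈0 | _        = trans (*-congʳ (trans (*-congʳ xu≈0) (zeroˡ _))) (zeroˡ _)
  ... | no _     | yes yw≈0 = trans (*-congʳ (trans (*-congˡ yw≈0) (zeroʳ _))) (zeroˡ _)
  ... | no xu≉0  | no yw≉0  with u ≟ᶠ w | arc D u w in uw
  ...   | yes ≡-refl | _     = ⊥-elim (¬touch (inj₁ (u , xu≉0 , yw≉0)))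
  ...   | no _       | true  = ⊥-elim (¬touch (inj₂ (u , w , xu≉0 , yw≉0 , uw)))
  ...   | no u≢w     | false = trans (*-congˡ (offArc≈0 u w u≢w uw)) (zeroʳ _)

  outerᵀ-*-≈0 : ∀ {n} (A : Matrix ℝ n) {x : Vector ℝ n} (y : Vector ℝ n) →
    (∀ w → sumFin ℝ (λ k → x k * A k w) ≈ 0#) →
    ∀ u w → sumFin ℝ (λ k → outer x y k u * A k w) ≈ 0#
  outerᵀ-*-≈0 A {x} y xA≈0 u w = begin
    sumFin ℝ (λ k → (x k * y u) * A k w)
      ≈⟨ sumFin-cong (λ k → xy∙z≈y∙xz (x k) (y u) (A k w)) ⟩
    sumFin ℝ (λ k → y u * (x k * A k w))
      ≈⟨ sumFin-≈0-*ˡ (y u) (λ k → x k * A k w) (xA≈0 w) ⟩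
    0# ∎

  *-outerᵀ-≈0 : ∀ {n} (A : Matrix ℝ n) (x : Vector ℝ n) {y : Vector ℝ n} →
    (∀ u → sumFin ℝ (λ k → A u k * y k) ≈ 0#) →
    ∀ u w → sumFin ℝ (λ k → A u k * outer x y w k) ≈ 0#
  *-outerᵀ-≈0 A x {y} Ay≈0 u w = begin
    sumFin ℝ (λ k → A u k * (x w * y k))
      ≈⟨ sumFin-cong (λ k → x∙yz≈y∙xz (A u k) (x w) (y k)) ⟩
    sumFin ℝ (λ k → x w * (A u k * y k))
      ≈⟨ sumFin-≈0-*ˡ (x w) (λ k → A u k * y k) (Ay≈0 u) ⟩
    0# ∎

mainTheorem6 : ∀ {c ℓ : Level} (ℝ : RealField c ℓ) {n : ℕ} (D : Digraph n) (A : Matrix ℝ n) →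
    InQ ℝ D A → ASAP ℝ A → SP ℝ D A
mainTheorem6 ℝ D A (_ , _ , offArc≈0) asap x y x≉0 xA≈0 y≉0 Ay≈0 =
  decidable-stable (touch? D x y) λ ¬touch →
    let (i , xᵢ≉0) = ¬IsZeroVec⇒∃supp x≉0
        (j , yⱼ≉0) = ¬IsZeroVec⇒∃supp y≉0
        xyᵀ≈0 = asap (outer x y) (outer-∘-≈0 D A offArc≈0 ¬touch)
                     (outerᵀ-*-≈0 A y xA≈0) (*-outerᵀ-≈0 A x Ay≈0)
    in x*y≉0 xᵢ≉0 yⱼ≉0 (xyᵀ≈0 i j)
  where open RealMatrixLemmas ℝ
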